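{- For any derivable judgement (of the form $\Gamma\vdash A$ or $\Gamma\vdash S\triangleright\Delta$) there is a unique derivation. The problem of derivability of judgements is decidable.
   Context: Variables $x,y,z,\ldots$; $\mathsf{x},\mathsf{y},\mathsf{z}$ range over variables. Terms and substitutions of $\lambda\alpha$: $A,B::=\mathsf{x}\mid AB\mid\lambda\mathsf{x}.A\mid S\circ A$, $S::=[B/\mathsf{x}]\mid W\mathsf{x}\mid\{\mathsf{y}\mathsf{x}\}\mid S_{\mathsf{x}}$. A context $\Gamma$ is a pair $G,L$ of a finite set $G$ of variables and a finite list $L$ of variables with repetitions allowed; $\mathsf{x}\in\Gamma$ means $\mathsf{x}\in G$ or $\mathsf{x}$ occurs in $L$; $\Gamma,\mathsf{x}$ denotes $G,(L,\mathsf{x})$; a context with empty list is written $G$. Judgements $\Gamma\vdash A$ and $\Gamma\vdash S\triangleright\Delta$ are derived exactly by the rules: (R1) $G\vdash\mathsf{x}$ if $\mathsf{x}\in G$; (R2) $\Gamma,\mathsf{x}\vdash\mathsf{x}$; (R3) from $\Gamma\vdash\mathsf{x}$ infer $\Gamma,\mathsf{y}\vdash\mathsf{x}$ ($\mathsf{x}\neq\mathsf{y}$); (R4) from $\Gamma\vdash A$, $\Gamma\vdash B$ infer $\Gamma\vdash AB$; (R5) from $\Gamma,\mathsf{x}\vdash A$ infer $\Gamma\vdash\lambda\mathsf{x}.A$; (R6) from $\Gamma\vdash S\triangleright\Delta$, $\Delta\vdash A$ infer $\Gamma\vdash S\circ A$; (R7) from $\Gamma\vdash B$ infer $\Gamma\vdash[B/\mathsf{x}]\triangleright\Gamma,\mathsf{x}$;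 (R8) $\Gamma,\mathsf{x}\vdash W\mathsf{x}\triangleright\Gamma$; (R9) $\Gamma,\mathsf{y}\vdash\{\mathsf{y}\mathsf{x}\}\triangleright\Gamma,\mathsf{x}$; (R10) from $\Gamma\vdash S\triangleright\Delta$ infer $\Gamma,\mathsf{x}\vdash S_{\mathsf{x}}\triangleright\Delta,\mathsf{x}$. -}

module Defs where

open import Data.Nat using (ℕ; _<_; _≟_)
open import Data.List using (List)
open import Data.List.Relation.Unary.Linked using (Linked)
open import Data.List.Membership.DecPropositional _≟_ using (_∈?_)
open import Relation.Nullary.Decidable using (True; False)

Var : Set
Var = ℕ

mutual
  data Term : Set where
    var  : Var → Term
    app  : Term → Term → Term
    lam  : Var → Term → Term
    _∘ₛ_ : Subst → Term → Term

  data Subst : Set where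
    sub   : Term → Var → Subst
    W     : Var → Subst
    ren   : Var → Var → Subst
    lift  : Subst → Var → Subst

-- Finite sets of variables, represented canonically as strictly
-- increasing lists (so that equal sets are equal values).
record FinSet : Set where
  constructor finSet
  field
    elems  : List Var
    sorted : Linked _<_ elems
open FinSet public

-- x ∈ G, as a decidable (proof-irrelevant) side condition.
_∈G_ : Var → FinSet → Set
x ∈G G = True (x ∈? elems G)

-- Contexts Γ = G , L : a finite set G followed by a list L
-- (with repetitions), written as snoc-list: ⟨ G ⟩ is the context with
-- empty list, Γ , x appends x at the end of the list.
infixl 5 _,_
data Ctx : Set where
  ⟨_⟩ : FinSet → Ctx
  _,_ : Ctx → Var → Ctx

_≠_ : Var → Var → Set
x ≠ y = False (x ≟ y)

infix 4 _⊢_ _⊢_▷_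
mutual
  data _⊢_ : Ctx → Term → Set where
    R1 : ∀ {G x} → x ∈G G → ⟨ G ⟩ ⊢ var x
    R2 : ∀ {Γ x} → (Γ , x) ⊢ var x
    R3 : ∀ {Γ x y} → x ≠ y → Γ ⊢ var x → (Γ , y) ⊢ var x
    R4 : ∀ {Γ A B} → Γ ⊢ A → Γ ⊢ B → Γ ⊢ app A B
    R5 : ∀ {Γ x A} → (Γ , x) ⊢ A → Γ ⊢ lam x A
    R6 : ∀ {Γ Δ S A} → Γ ⊢ S ▷ Δ → Δ ⊢ A → Γ ⊢ S ∘ₛ A

  data _⊢_▷_ : Ctx → Subst → Ctx → Set where
    R7  : ∀ {Γ B x} → Γ ⊢ B → Γ ⊢ sub B x ▷ (Γ , x)
    R8  : ∀ {Γ x} → (Γ , x) ⊢ W x ▷ Γ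
    R9  : ∀ {Γ x y} → (Γ , y) ⊢ ren y x ▷ (Γ , x)
    R10 : ∀ {Γ Δ S x} → Γ ⊢ S ▷ Δ → (Γ , x) ⊢ lift S x ▷ (Δ , x)

module Submission where

-- The rules are syntax-directed: for a term judgement Γ ⊢ A the head of A
-- selects the rule, except for variables, where the shape of Γ and the
-- side condition x ≠ y separate R1, R2 and R3.  For a substitution judgement
-- Γ ⊢ S ▷ Δ the head of S selects the rule and, moreover, the target Δ is
-- determined by Γ and S (`target-unique`).  This is the only non-local
-- ingredient: in R6 the intermediate context Δ does not occur in the
-- conclusion, and target uniqueness is what identifies it in two
-- derivations.  Side conditions are proof-irrelevant, so
-- uniqueness (`unique-⊢`, `unique-▷`) follows by mutual induction.

open import Defs
open import Data.Nat using (_≟_)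
open import Data.List.Membership.DecPropositional _≟_ using (_∈?_)
open import Data.Bool.Properties using (T-irrelevant)
import Data.List.Properties as List
import Data.List.Relation.Unary.Linked as Linked
open import Data.Nat.Properties using (<-irrelevant)
open import Data.Product using (_×_; ∃) renaming (_,_ to _,,_)
open import Relation.Binary.Definitions using (DecidableEquality)
open import Relation.Binary.PropositionalEquality using (_≡_; refl; cong; cong₂)
open import Relation.Nullary using (Dec; yes; no)
open import Relation.Nullary.Decidable
  using (toWitness; fromWitness; toWitnessFalse; fromWitnessFalse)

-- A finite set is determined by its list of elements: sortedness proofs
-- are unique because _<_ on ℕ is proof-irrelevant.
finSet-≡ : {G H : FinSet} → elems G ≡ elems H → G ≡ H
finSet-≡ {finSet xs s} {finSet .xs s'} refl =
  cong (finSet xs) (Linked.irrelevant <-irrelevant s s')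

_≟ᶠ_ : DecidableEquality FinSet
G ≟ᶠ H with List.≡-dec _≟_ (elems G) (elems H)
... | yes eq = yes (finSet-≡ eq)
... | no ne  = no λ { refl → ne refl }

_≟ᶜ_ : DecidableEquality Ctx
⟨ G ⟩ ≟ᶜ ⟨ H ⟩ with G ≟ᶠ H
... | yes refl = yes refl
... | no ne    = no λ { refl → ne refl }
⟨ G ⟩   ≟ᶜ (Δ , y) = no λ ()
(Γ , x) ≟ᶜ ⟨ H ⟩   = no λ ()
(Γ , x) ≟ᶜ (Δ , y) with Γ ≟ᶜ Δ | x ≟ y
... | yes refl | yes refl = yes refl
... | no ne    | _        = no λ { refl → ne refl }
... | _        | no ne    = no λ { refl → ne refl }

target-unique : ∀ {Γ S Δ Δ'} → Γ ⊢ S ▷ Δ → Γ ⊢ S ▷ Δ' → Δ ≡ Δ'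
target-unique (R7 _)  (R7 _)  = refl
target-unique R8      R8      = refl
target-unique R9      R9      = refl
target-unique (R10 d) (R10 e) = cong (_, _) (target-unique d e)

⊥-from-≠ : ∀ {x} {B : Set} → x ≠ x → B
⊥-from-≠ x≠x with () ← toWitnessFalse x≠x refl

-- The mixed cases R2/R3 are impossible since
-- R3 at (Γ , x) ⊢ x would need x ≠ x; in the R6 case the two intermediate
-- contexts are first identified by target uniqueness.

mutual
  unique-⊢ : ∀ {Γ A} (d₁ d₂ : Γ ⊢ A) → d₁ ≡ d₂
  unique-⊢ (R1 p)     (R1 q)     = cong R1 (T-irrelevant p q)
  unique-⊢ R2         R2         = refl
  unique-⊢ R2         (R3 x≠x _) = ⊥-from-≠ x≠x
  unique-⊢ (R3 x≠x _) R2         = ⊥-from-≠ x≠x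
  unique-⊢ (R3 p d)   (R3 q e)   = cong₂ R3 (T-irrelevant p q) (unique-⊢ d e)
  unique-⊢ (R4 a b)   (R4 c d)   = cong₂ R4 (unique-⊢ a c) (unique-⊢ b d)
  unique-⊢ (R5 a)     (R5 b)     = cong R5 (unique-⊢ a b)
  unique-⊢ (R6 s a)   (R6 t b)   with target-unique s t
  ... | refl = cong₂ R6 (unique-▷ s t) (unique-⊢ a b)

  unique-▷ : ∀ {Γ S Δ} (d₁ d₂ : Γ ⊢ S ▷ Δ) → d₁ ≡ d₂
  unique-▷ (R7 a)  (R7 b)  = cong R7 (unique-⊢ a b)
  unique-▷ R8      R8      = refl
  unique-▷ R9      R9      = refl
  unique-▷ (R10 s) (R10 t) = cong R10 (unique-▷ s t)

decide-var : ∀ Γ x → Dec (Γ ⊢ var x)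
decide-var ⟨ G ⟩ x with x ∈? elems G
... | yes x∈G = yes (R1 (fromWitness x∈G))
... | no  x∉G = no λ { (R1 p) → x∉G (toWitness p) }
decide-var (Γ , y) x with x ≟ y
... | yes refl = yes R2
... | no  x≠y with decide-var Γ x
...   | yes d = yes (R3 (fromWitnessFalse x≠y) d)
...   | no ¬d = no λ { R2 → x≠y refl ; (R3 _ d) → ¬d d }

R6-inversion : ∀ {Γ S Δ A} → Γ ⊢ S ▷ Δ → Γ ⊢ S ∘ₛ A → Δ ⊢ A
R6-inversion s (R6 t a) with target-unique s t
... | refl = a

mutual
  decide-⊢ : ∀ Γ A → Dec (Γ ⊢ A)
  decide-⊢ Γ (var x) = decide-var Γ x
  decide-⊢ Γ (app A B) with decide-⊢ Γ A | decide-⊢ Γ B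
  ... | yes a | yes b = yes (R4 a b)
  ... | no ¬a | _     = no λ { (R4 a _) → ¬a a }
  ... | _     | no ¬b = no λ { (R4 _ b) → ¬b b }
  decide-⊢ Γ (lam x A) with decide-⊢ (Γ , x) A
  ... | yes a = yes (R5 a)
  ... | no ¬a = no λ { (R5 a) → ¬a a }
  decide-⊢ Γ (S ∘ₛ A) with infer-target Γ S
  ... | no ¬s = no λ { (R6 s _) → ¬s (_ ,, s) }
  ... | yes (Δ ,, s) with decide-⊢ Δ A
  ...   | yes a = yes (R6 s a)
  ...   | no ¬a = no λ d → ¬a (R6-inversion s d)

  infer-target : ∀ Γ S → Dec (∃ λ Δ → Γ ⊢ S ▷ Δ)
  infer-target Γ (sub B x) with decide-⊢ Γ B
  ... | yes b = yes (_ ,, R7 b)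
  ... | no ¬b = no λ { (_ ,, R7 b) → ¬b b }
  infer-target ⟨ G ⟩ (W x) = no λ { (_ ,, ()) }
  infer-target (Γ , y) (W x) with y ≟ x
  ... | yes refl = yes (_ ,, R8)
  ... | no  y≠x  = no λ { (_ ,, R8) → y≠x refl }
  infer-target ⟨ G ⟩ (ren y x) = no λ { (_ ,, ()) }
  infer-target (Γ , z) (ren y x) with z ≟ y
  ... | yes refl = yes (_ ,, R9)
  ... | no  z≠y  = no λ { (_ ,, R9) → z≠y refl }
  infer-target ⟨ G ⟩ (lift S x) = no λ { (_ ,, ()) }
  infer-target (Γ , z) (lift S x) with z ≟ x | infer-target Γ S
  ... | yes refl | yes (_ ,, s) = yes (_ ,, R10 s)
  ... | no  z≠x  | _            = no λ { (_ ,, R10 _) → z≠x refl }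
  ... | _        | no ¬s        = no λ { (_ ,, R10 s) → ¬s (_ ,, s) }

decide-▷ : ∀ Γ S Δ → Dec (Γ ⊢ S ▷ Δ)
decide-▷ Γ S Δ with infer-target Γ S
... | no ¬s = no λ s → ¬s (_ ,, s)
... | yes (Δ' ,, s) with Δ' ≟ᶜ Δ
...   | yes refl = yes s
...   | no  Δ'≠Δ = no λ t → Δ'≠Δ (target-unique s t)

mainTheorem9 : ((Γ : Ctx) (A : Term) (d₁ d₂ : Γ ⊢ A) → d₁ ≡ d₂)
    × ((Γ : Ctx) (S : Subst) (Δ : Ctx) (d₁ d₂ : Γ ⊢ S ▷ Δ) → d₁ ≡ d₂)
    × ((Γ : Ctx) (A : Term) → Dec (Γ ⊢ A))
    × ((Γ : Ctx) (S : Subst) (Δ : Ctx) → Dec (Γ ⊢ S ▷ Δ))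
mainTheorem9 =
    (λ _ _ → unique-⊢)
  ,, (λ _ _ _ → unique-▷)
  ,, decide-⊢
  ,, decide-▷
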